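{- Let $G$ be a bridgeless cubic graph, let $F$ be a $2$-factor of $G$ such that $G/F$ is $5$-odd-edge-connected, and let $>_1$ be a strict total order on $\mathcal{C}^I_G(F)$. Then $\mathcal{P}_G(F,>_1)$ is a partition of $\mathcal{C}^P_G(F,>_1)$ into two-element subsets, and for each $\{C,C^*\}\in\mathcal{P}_G(F,>_1)$ the circuits $C$ and $C^*$ are both contained in a subgraph of $G$ isomorphic to the graph $S$.
   Context: A circuit is a connected $2$-regular subgraph; a $5$-circuit has $5$ edges. A $2$-factor $F$ of $G$ is a spanning $2$-regular subgraph; its components are the circuits of $F$. $G/F$ is obtained by contracting all edges of $F$. A graph $H$ is $5$-odd-edge-connected if $|\partial_H(A)|\notin\{1,3\}$ for all $A\subseteq V(H)$, where $\partial_H(A)$ is the set of edges with exactly one end in $A$. Two circuits intersect if they share an edge. $\mathcal{C}^I_G$ is the set of $5$-circuits of $G$ intersecting some other $5$-circuit of $G$ in exactly one edge or exactly two adjacent edges; $\mathcal{C}^I_G(F)$ is the set of circuits of $F$ in $\mathcal{C}^I_G$. For $C\in\mathcal{C}^I_G(F)$ let $\mathcal{S}(C)$ be the set of circuits $C^*\neq C$ of $F$ such that some $5$-circuit of $G$ intersects both $C$ and $C^*$. Define $f_{>_1}(C)$: if $\mathcal{S}(C)\setminus\mathcal{C}^I_G(F)\neq\emptyset$, it is an (arbitrarily fixed) element of $\mathcal{S}(C)\setminus\mathcal{C}^I_G(F)$; otherwise it is the smallest element of $\mathcal{S}(C)$ with respect to $>_1$. Let $\mathcal{C}^P_G(F,>_1)$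 be the set of $C\in\mathcal{C}^I_G(F)$ with $f_{>_1}(C)\in\mathcal{C}^I_G(F)$ and $f_{>_1}(f_{>_1}(C))=C$, and $\mathcal{P}_G(F,>_1)=\{\{C,f_{>_1}(C)\}: C\in\mathcal{C}^P_G(F,>_1)\}$. The graph $S$ is obtained from two vertex-disjoint $5$-circuits $a_1a_2xyza_1$ and $b_1b_2b_3pqb_1$ by adding the edges $a_2b_1$ and $a_1b_3$ (so $S$ has $10$ vertices and $12$ edges, and $a_1a_2b_1b_2b_3a_1$ is a $5$-circuit). -}

module Defs where

open import Data.Nat using (ℕ; zero; suc; _+_)
open import Data.Bool using (Bool; true; false; if_then_else_; _xor_)
open import Data.Fin using (Fin; _≟_; suc)
open import Data.Fin.Patterns
open import Data.Fin.Subset using (Subset; ⊤; ⁅_⁆; _∈_; _∉_; _⊆_; _∩_; _∪_; ∣_∣; Nonempty)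
open import Data.Vec using (lookup)
open import Data.List using (List; map; allFin)
open import Data.Nat.ListAction using (sum)
open import Data.Product using (Σ; ∃; ∃-syntax; _×_; _,_)
open import Data.Sum using (_⊎_)
open import Data.Empty using (⊥)
open import Relation.Nullary using (¬_; Dec; yes; no)
open import Relation.Nullary.Decidable using (⌊_⌋)
open import Relation.Binary.PropositionalEquality using (_≡_; _≢_)
open import Function.Definitions using (Injective)

-- Finite multigraphs: vertices Fin n, edges Fin m, each edge e has two
-- (unordered) ends end₁ e, end₂ e.  Parallel edges allowed; loops allowed
-- by the type (bridgeless cubic graphs have none anyway).

record Graph : Set where
  field
    n    : ℕ
    m    : ℕ
    end₁ : Fin m → Fin n
    end₂ : Fin m → Fin n
open Graph public

-- subgraphs are given by their edge sets; vertex sets by Subset n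
EdgeSet : Graph → Set
EdgeSet G = Subset (m G)

VertexSet : Graph → Set
VertexSet G = Subset (n G)

module _ (G : Graph) where

  countE : (Fin (m G) → Bool) → ℕ
  countE p = sum (map (λ e → if p e then 1 else 0) (allFin (m G)))

  -- number of ends of e at v (a loop counts twice)
  endsAt : Fin (n G) → Fin (m G) → ℕ
  endsAt v e = (if ⌊ end₁ G e ≟ v ⌋ then 1 else 0) + (if ⌊ end₂ G e ≟ v ⌋ then 1 else 0)

  deg : EdgeSet G → Fin (n G) → ℕ
  deg D v = sum (map (λ e → if lookup D e then endsAt v e else 0) (allFin (m G)))

  Cubic : Set
  Cubic = ∀ v → deg ⊤ v ≡ 3

  inCut : VertexSet G → Fin (m G) → Bool
  inCut A e = lookup A (end₁ G e) xor lookup A (end₂ G e)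

  cutSize : VertexSet G → ℕ
  cutSize A = countE (inCut A)

  IsBridge : Fin (m G) → Set
  IsBridge e = ∃[ A ] (∀ f → (inCut A f ≡ true → f ≡ e) × (f ≡ e → inCut A f ≡ true))

  Bridgeless : Set
  Bridgeless = ∀ e → ¬ IsBridge e

  Meets : Fin (m G) → Fin (m G) → Set
  Meets e f = (end₁ G e ≡ end₁ G f) ⊎ (end₁ G e ≡ end₂ G f)
            ⊎ (end₂ G e ≡ end₁ G f) ⊎ (end₂ G e ≡ end₂ G f)

  -- the subgraph with edge set D (and vertex set the ends of its edges)
  -- is connected: every nonempty proper part X of D has an edge meeting D ∖ X
  ConnectedE : EdgeSet G → Set
  ConnectedE D = ∀ X → X ⊆ D → Nonempty X → (∃[ f ] (f ∈ D × f ∉ X)) →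
                 ∃[ e ] ∃[ f ] (e ∈ X × f ∈ D × f ∉ X × Meets e f)

  Circuit : EdgeSet G → Set
  Circuit D = Nonempty D × (∀ v → deg D v ≡ 0 ⊎ deg D v ≡ 2) × ConnectedE D

  Circuit5 : EdgeSet G → Set
  Circuit5 D = Circuit D × ∣ D ∣ ≡ 5

  TwoFactor : EdgeSet G → Set
  TwoFactor F = ∀ v → deg F v ≡ 2

  CircuitOf : EdgeSet G → EdgeSet G → Set
  CircuitOf F C = Circuit C × C ⊆ F

  Intersect : EdgeSet G → EdgeSet G → Set
  Intersect C D = Nonempty (C ∩ D)

  TwoAdjacentEdges : EdgeSet G → Set
  TwoAdjacentEdges X = ∃[ e ] ∃[ f ] (e ≢ f × Meets e f × X ≡ ⁅ e ⁆ ∪ ⁅ f ⁆)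

  InCI : EdgeSet G → Set
  InCI C = Circuit5 C × ∃[ D ] (Circuit5 D × D ≢ C ×
             (∣ C ∩ D ∣ ≡ 1 ⊎ TwoAdjacentEdges (C ∩ D)))

  -- The vertices of G/F are the circuits of F
  -- and its edges are the edges of G not in F; a vertex set of G/F is thus a
  -- vertex set A of G that is a union of circuits of F (no edge of F crosses A),
  -- and ∂_{G/F} of it is exactly ∂_G(A).
  FiveOddEdgeConnectedQuotient : EdgeSet G → Set
  FiveOddEdgeConnectedQuotient F =
    ∀ (A : VertexSet G) → (∀ e → e ∈ F → inCut A e ≡ false) →
      cutSize A ≢ 1 × cutSize A ≢ 3

  module _ (F : EdgeSet G) where

    CIF : EdgeSet G → Set
    CIF C = CircuitOf F C × InCI C

    SS : EdgeSet G → EdgeSet G → Set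
    SS C X = CircuitOf F X × X ≢ C ×
             ∃[ D ] (Circuit5 D × Intersect D C × Intersect D X)

    StrictTotalOnCIF : (EdgeSet G → EdgeSet G → Set) → Set
    StrictTotalOnCIF _>₁_ =
        (∀ X → CIF X → ¬ (X >₁ X))
      × (∀ X Y Z → CIF X → CIF Y → CIF Z → X >₁ Y → Y >₁ Z → X >₁ Z)
      × (∀ X Y → CIF X → CIF Y → X ≢ Y → (X >₁ Y) ⊎ (Y >₁ X))

    module _ (_>₁_ : EdgeSet G → EdgeSet G → Set) (f : EdgeSet G → EdgeSet G) where

      -- f is a valid choice of f_{>₁} on 𝒞^I_G(F): if 𝒮(C) ∖ 𝒞^I_G(F) ≠ ∅ then
      -- f C is some element of it (arbitrary), otherwise f C is the smallest
      -- element of 𝒮(C) w.r.t. >₁ (every other element Y satisfies Y >₁ f C).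
      IsF : Set
      IsF = ∀ C → CIF C →
          ((∃[ X ] (SS C X × ¬ CIF X)) → SS C (f C) × ¬ CIF (f C))
        × (¬ (∃[ X ] (SS C X × ¬ CIF X)) →
             SS C (f C) × (∀ Y → SS C Y → Y ≢ f C → Y >₁ f C))

      CP : EdgeSet G → Set
      CP C = CIF C × CIF (f C) × f (f C) ≡ C

      InBlock : EdgeSet G → EdgeSet G → Set
      InBlock C X = (X ≡ C) ⊎ (X ≡ f C)

      -- 𝒫_G(F,>₁) = {{C, f C} : C ∈ 𝒞^P} is a partition of 𝒞^P into
      -- two-element subsets
      PartitionIntoPairs : Set
      PartitionIntoPairs =
          (∀ C → CP C → C ≢ f C × (∀ X → InBlock C X → CP X))
        × (∀ C D → CP C → CP D →
             (∀ X → (InBlock C X → InBlock D X) × (InBlock D X → InBlock C X))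
           ⊎ (∀ X → ¬ (InBlock C X × InBlock D X)))
        × (∀ X → CP X → ∃[ C ] (CP C × InBlock C X))

record Embedding (H G : Graph) : Set where
  field
    φ      : Fin (n H) → Fin (n G)
    ψ      : Fin (m H) → Fin (m G)
    φ-inj  : Injective _≡_ _≡_ φ
    ψ-inj  : Injective _≡_ _≡_ ψ
    ends   : ∀ e → (end₁ G (ψ e) ≡ φ (end₁ H e) × end₂ G (ψ e) ≡ φ (end₂ H e))
                 ⊎ (end₁ G (ψ e) ≡ φ (end₂ H e) × end₂ G (ψ e) ≡ φ (end₁ H e))
open Embedding public

ContainedIn : {H G : Graph} → Embedding H G → EdgeSet G → Set
ContainedIn {H} {G} emb D = ∀ e → e ∈ D → ∃[ i ] (ψ emb i ≡ e)

-- The graph S.  Vertices: a₁=0 a₂=1 x=2 y=3 z=4 b₁=5 b₂=6 b₃=7 p=8 q=9.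
-- Edges: the 5-circuits a₁a₂xyza₁ and b₁b₂b₃pqb₁, plus a₂b₁ and a₁b₃.
S-end₁ : Fin 12 → Fin 10
S-end₁ 0F  = 0F
S-end₁ 1F  = 1F
S-end₁ 2F  = 2F
S-end₁ 3F  = 3F
S-end₁ 4F  = 4F
S-end₁ 5F  = 5F
S-end₁ 6F  = 6F
S-end₁ 7F  = 7F
S-end₁ 8F  = 8F
S-end₁ 9F  = 9F
S-end₁ (suc (suc 8F)) = 1F
S-end₁ (suc (suc 9F)) = 0F

S-end₂ : Fin 12 → Fin 10
S-end₂ 0F  = 1F
S-end₂ 1F  = 2F
S-end₂ 2F  = 3F
S-end₂ 3F  = 4F
S-end₂ 4F  = 0F
S-end₂ 5F  = 6F
S-end₂ 6F  = 7F
S-end₂ 7F  = 8F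
S-end₂ 8F  = 9F
S-end₂ 9F  = 5F
S-end₂ (suc (suc 8F)) = 5F
S-end₂ (suc (suc 9F)) = 7F

S : Graph
S = record { n = 10 ; m = 12 ; end₁ = S-end₁ ; end₂ = S-end₂ }

module Submission where

-- Write the 5-circuit D witnessing f C ∈ 𝒮(C) as a closed walk of five edges.  Every vertex of the
-- cubic graph G carries two edges of the 2-factor F and one edge outside F, so two consecutive edges
-- of D are never both outside F, and an F-edge of D next to an edge of a circuit of F belongs to that
-- circuit.  As D meets the two distinct, hence vertex-disjoint, circuits C and f C of F, it consists
-- of a path in C, an edge outside F, a path in f C and a second edge outside F, the two paths having
-- one and two edges.  Both 5-circuits together with these two edges form a copy of S.  The partition
-- statement only uses that f is a fixed-point-free involution on 𝒞^P_G(F, >₁).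

open import Defs
open import Algebra.Properties.CommutativeSemigroup using (x∙yz≈y∙xz)
open import Algebra.Definitions.RawMonoid using (sum)
open import Data.Bool as Bool using (true; false; if_then_else_)
open import Data.Bool.Properties using (¬-not)
open import Data.Empty using (⊥; ⊥-elim)
open import Data.Fin using (Fin; zero; suc; _≟_)
open import Data.Fin.Patterns using (0F; 1F; 2F; 3F; 4F; 5F; 6F; 7F; 8F; 9F)
open import Data.Fin.Subset using (Subset; _∈_; _∉_; _⊆_; _∩_; ∣_∣; ⊤; ⁅_⁆)
open import Data.Fin.Subset.Properties
  using (x∈⁅x⁆; x≢y⇒x∉⁅y⁆; ∈⊤; _∈?_; ⊆-antisym; p∩q⊆p; x∈p∩q⁺; x∈p∩q⁻)
open import Data.List as List using (List; []; _∷_; _++_; length; map; tabulate)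
open import Data.List.Membership.Propositional using () renaming (_∈_ to _∈ˡ_)
open import Data.List.Properties using (map-cong-local)
open import Data.List.Membership.Propositional.Properties using (∈-lookup; ∈-++⁺ˡ; ∈-++⁺ʳ; ∈-++⁻)
open import Data.List.Relation.Binary.Disjoint.Propositional using (Disjoint)
open import Data.List.Relation.Unary.All using (All; []; _∷_)
open import Data.List.Relation.Unary.All.Properties using (¬Any⇒All¬)
import Data.List.Relation.Unary.All as All
open import Data.List.Relation.Unary.Any as Any using (here; there; any?)
open import Data.List.Relation.Unary.Any.Properties using (lookup-index)
open import Data.List.Relation.Unary.Unique.Propositional using (Unique; []; _∷_)
open import Data.List.Relation.Unary.Unique.Propositional.Properties using (++⁺)
open import Data.Nat using (ℕ; zero; suc; _+_; _≤_; _<_; z≤n; s≤s; +-0-rawMonoid)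
open import Data.Nat.ListAction as ListSum using ()
open import Data.Nat.Properties hiding (_≟_)
open import Data.Product using (Σ; _×_; _,_; ∃-syntax; proj₁; proj₂)
open import Data.Sum using (_⊎_; inj₁; inj₂; [_,_]′)
open import Data.Vec as Vec using (lookup)
open import Data.Vec.Functional using (Vector; updateAt)
open import Data.Vec.Functional.Properties using (updateAt-updates; updateAt-minimal)
import Data.Vec.Properties as Vecₚ
open import Function using (_∘_; const; id; _⇔_; Equivalence; mk⇔)
open import Function.Definitions using (Injective)
open import Relation.Binary.PropositionalEquality
open import Relation.Binary.Definitions using (DecidableEquality)
open import Relation.Nullary using (¬_; Dec; yes; no)
open import Relation.Nullary.Decidable using (⌊_⌋)

-- Finite sums and cardinalities

∑ : ∀ {m} → Vector ℕ m → ℕ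
∑ = sum +-0-rawMonoid

sum-map-tabulate : ∀ {k} {A : Set} (g : Fin k → A) (h : A → ℕ) →
  ListSum.sum (map h (tabulate g)) ≡ ∑ (h ∘ g)
sum-map-tabulate {zero}  g h = refl
sum-map-tabulate {suc k} g h = cong (h (g zero) +_) (sum-map-tabulate (g ∘ suc) h)

erase : ∀ {m} → Fin m → Vector ℕ m → Vector ℕ m
erase i h = updateAt h i (const 0)

∑-erase : ∀ {m} (i : Fin m) (h : Vector ℕ m) → ∑ h ≡ h i + ∑ (erase i h)
∑-erase zero    h = refl
∑-erase (suc i) h = begin
  h zero + ∑ (h ∘ suc)                         ≡⟨ cong (h zero +_) (∑-erase i (h ∘ suc)) ⟩
  h zero + (h (suc i) + ∑ (erase i (h ∘ suc)))  ≡⟨ x∙yz≈y∙xz +-commutativeSemigroup (h zero) (h (suc i)) _ ⟩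
  h (suc i) + (h zero + ∑ (erase i (h ∘ suc)))  ∎
  where open ≡-Reasoning

erase-at : ∀ {m} (i : Fin m) (h : Vector ℕ m) → erase i h i ≡ 0
erase-at i h = updateAt-updates i h

erase-elsewhere : ∀ {m} {i j : Fin m} (h : Vector ℕ m) → j ≢ i → erase i h j ≡ h j
erase-elsewhere {i = i} {j} h j≢i = updateAt-minimal j i h j≢i

∑-positive : ∀ {m} (h : Vector ℕ m) → 0 < ∑ h → ∃[ i ] 0 < h i
∑-positive {suc m} h 0<∑ with h zero in eq
... | suc _ = zero , subst (0 <_) (sym eq) (s≤s z≤n)
... | zero with ∑-positive (h ∘ suc) 0<∑
...   | i , 0<hi = suc i , 0<hi

erase-positive : ∀ {m} {i j : Fin m} (h : Vector ℕ m) → 0 < erase i h j → j ≢ i × 0 < h j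
erase-positive {i = i} {j} h 0<e with j ≟ i
... | yes refl = ⊥-elim (<-irrefl (sym (erase-at i h)) 0<e)
... | no j≢i   = j≢i , subst (0 <_) (erase-elsewhere h j≢i) 0<e

positive-besides : ∀ {m} (h : Vector ℕ m) i → h i < ∑ h → ∃[ j ] (j ≢ i × 0 < h j)
positive-besides h i hi<∑ =
  let j , 0<ej = ∑-positive (erase i h) (+-cancelˡ-< (h i) 0 _ 0<rest) in j , erase-positive h 0<ej
  where
  0<rest : h i + 0 < h i + ∑ (erase i h)
  0<rest = subst₂ _<_ (sym (+-identityʳ (h i))) (∑-erase i h) hi<∑

sum-distinct≤∑ : ∀ {m} (h : Vector ℕ m) {xs} → Unique xs → ListSum.sum (map h xs) ≤ ∑ h
sum-distinct≤∑ h {[]}     []             = z≤n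
sum-distinct≤∑ h {x ∷ xs} (x∉xs ∷ uniq) = begin
  h x + ListSum.sum (map h xs)          ≡⟨ cong (λ ys → h x + ListSum.sum ys) (map-cong-local (untouched x∉xs)) ⟩
  h x + ListSum.sum (map (erase x h) xs) ≤⟨ +-monoʳ-≤ (h x) (sum-distinct≤∑ (erase x h) uniq) ⟩
  h x + ∑ (erase x h)                    ≡⟨ ∑-erase x h ⟨
  ∑ h                                    ∎
  where
  open ≤-Reasoning
  untouched : ∀ {ys} → All (x ≢_) ys → All (λ y → h y ≡ erase x h y) ys
  untouched []             = []
  untouched (x≢y ∷ x≢ys) = sym (erase-elsewhere h (≢-sym x≢y)) ∷ untouched x≢ys

length≤sum : ∀ {A : Set} (h : A → ℕ) {xs} → All (λ x → 1 ≤ h x) xs → length xs ≤ ListSum.sum (map h xs)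
length≤sum h []           = z≤n
length≤sum h (1≤hx ∷ 1≤h) = +-mono-≤ 1≤hx (length≤sum h 1≤h)

length≤∑ : ∀ {m} (h : Vector ℕ m) {xs} → Unique xs → All (λ x → 1 ≤ h x) xs → length xs ≤ ∑ h
length≤∑ h uniq 1≤h = ≤-trans (length≤sum h 1≤h) (sum-distinct≤∑ h uniq)

∑≤length : ∀ {m} (h : Vector ℕ m) xs → (∀ i → h i ≤ 1) → (∀ i → 0 < h i → i ∈ˡ xs) → ∑ h ≤ length xs
∑≤length h [] h≤1 support with ∑ h in eq
... | zero  = z≤n
... | suc _ with ∑-positive h (subst (0 <_) (sym eq) (s≤s z≤n))
...   | i , 0<hi with () ← support i 0<hi
∑≤length h (x ∷ xs) h≤1 support = begin
  ∑ h                 ≡⟨ ∑-erase x h ⟩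
  h x + ∑ (erase x h) ≤⟨ +-mono-≤ (h≤1 x) (∑≤length (erase x h) xs erased≤1 erased-support) ⟩
  suc (length xs)     ∎
  where
  open ≤-Reasoning
  erased≤1 : ∀ i → erase x h i ≤ 1
  erased≤1 i with i ≟ x
  ... | yes refl = subst (_≤ 1) (sym (erase-at x h)) z≤n
  ... | no i≢x   = subst (_≤ 1) (sym (erase-elsewhere h i≢x)) (h≤1 i)
  erased-support : ∀ i → 0 < erase x h i → i ∈ˡ xs
  erased-support i 0<ei with erase-positive h 0<ei
  ... | i≢x , 0<hi with support i 0<hi
  ...   | here i≡x  = ⊥-elim (i≢x i≡x)
  ...   | there i∈xs = i∈xs

indicator : ∀ {m} → Subset m → Vector ℕ m
indicator p i = if lookup p i then 1 else 0

∣p∣≡∑indicator : ∀ {m} (p : Subset m) → ∣ p ∣ ≡ ∑ (indicator p)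
∣p∣≡∑indicator Vec.[]          = refl
∣p∣≡∑indicator (true  Vec.∷ p) = cong suc (∣p∣≡∑indicator p)
∣p∣≡∑indicator (false Vec.∷ p) = ∣p∣≡∑indicator p

length≤∣p∣ : ∀ {m} {p : Subset m} {xs} → Unique xs → All (_∈ p) xs → length xs ≤ ∣ p ∣
length≤∣p∣ {p = p} uniq xs⊆p =
  subst (_ ≤_) (sym (∣p∣≡∑indicator p)) (length≤∑ (indicator p) uniq (All.map in⇒1≤ xs⊆p))
  where
  in⇒1≤ : ∀ {x} → x ∈ p → 1 ≤ indicator p x
  in⇒1≤ x∈p rewrite Vecₚ.[]=⇒lookup x∈p = s≤s z≤n

∣p∣≤length : ∀ {m} {p : Subset m} xs → (∀ {x} → x ∈ p → x ∈ˡ xs) → ∣ p ∣ ≤ length xs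
∣p∣≤length {p = p} xs p⊆xs =
  subst (_≤ length xs) (sym (∣p∣≡∑indicator p)) (∑≤length (indicator p) xs ≤1 support)
  where
  ≤1 : ∀ i → indicator p i ≤ 1
  ≤1 i with lookup p i
  ... | true  = ≤-refl
  ... | false = z≤n
  support : ∀ i → 0 < indicator p i → i ∈ˡ xs
  support i 0<pi with lookup p i in eq
  ... | true  = p⊆xs (Vecₚ.lookup⇒[]= i p eq)

_∈ˡ?_ : ∀ {m} (i : Fin m) xs → Dec (i ∈ˡ xs)
i ∈ˡ? xs = any? (i ≟_) xs

fromList : ∀ {m} → List (Fin m) → Subset m
fromList xs = Vec.tabulate (λ i → ⌊ i ∈ˡ? xs ⌋)

∈-fromList⁺ : ∀ {m} {xs : List (Fin m)} {i} → i ∈ˡ xs → i ∈ fromList xs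
∈-fromList⁺ {xs = xs} {i} i∈xs with i ∈ˡ? xs in eq
... | yes _ = Vecₚ.lookup⇒[]= i (fromList xs) (trans (Vecₚ.lookup∘tabulate _ i) (cong ⌊_⌋ eq))
... | no i∉xs = ⊥-elim (i∉xs i∈xs)

∈-fromList⁻ : ∀ {m} {xs : List (Fin m)} {i} → i ∈ fromList xs → i ∈ˡ xs
∈-fromList⁻ {xs = xs} {i} i∈ with i ∈ˡ? xs | trans (sym (Vecₚ.lookup∘tabulate _ i)) (Vecₚ.[]=⇒lookup i∈)
... | yes i∈xs | _ = i∈xs

lookup-injective : ∀ {A : Set} {xs : List A} → Unique xs → Injective _≡_ _≡_ (List.lookup xs)
lookup-injective (_ ∷ _)     {zero}  {zero}  _     = refl
lookup-injective (x∉xs ∷ _)  {zero}  {suc j} x≡xⱼ  = ⊥-elim (All.lookup x∉xs (∈-lookup j) x≡xⱼ)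
lookup-injective (x∉xs ∷ _)  {suc i} {zero}  xᵢ≡x  = ⊥-elim (All.lookup x∉xs (∈-lookup i) (sym xᵢ≡x))
lookup-injective (_ ∷ uniq)  {suc i} {suc j} xᵢ≡xⱼ = cong suc (lookup-injective uniq xᵢ≡xⱼ)

∈⇒lookup : ∀ {A : Set} {xs : List A} {x} → x ∈ˡ xs → ∃[ i ] List.lookup xs i ≡ x
∈⇒lookup x∈xs = Any.index x∈xs , sym (lookup-index x∈xs)

cyclicSuc : Fin 5 → Fin 5
cyclicSuc 0F = 1F
cyclicSuc 1F = 2F
cyclicSuc 2F = 3F
cyclicSuc 3F = 4F
cyclicSuc 4F = 0F

module Incidence (G : Graph) where

  Vertex Edge : Set
  Vertex = Fin (n G)
  Edge   = Fin (m G)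

  EndOf : Vertex → Edge → Set
  EndOf v e = end₁ G e ≡ v ⊎ end₂ G e ≡ v

  Joins : Edge → Vertex → Vertex → Set
  Joins e u w = (end₁ G e ≡ u × end₂ G e ≡ w) ⊎ (end₁ G e ≡ w × end₂ G e ≡ u)

  joins-end₁ : ∀ {e u w} → Joins e u w → EndOf u e
  joins-end₁ (inj₁ (p , _)) = inj₁ p
  joins-end₁ (inj₂ (_ , q)) = inj₂ q

  joins-end₂ : ∀ {e u w} → Joins e u w → EndOf w e
  joins-end₂ (inj₁ (_ , q)) = inj₂ q
  joins-end₂ (inj₂ (p , _)) = inj₁ p

  joins-sym : ∀ {e u w} → Joins e u w → Joins e w u
  joins-sym (inj₁ p) = inj₂ p
  joins-sym (inj₂ p) = inj₁ p

  joins-other-end : ∀ {v e} → EndOf v e → ∃[ w ] Joins e v w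
  joins-other-end {e = e} (inj₁ p) = end₂ G e , inj₁ (p , refl)
  joins-other-end {e = e} (inj₂ q) = end₁ G e , inj₂ (refl , q)

  endOf-joins : ∀ {e u w x} → Joins e u w → EndOf x e → x ≡ u ⊎ x ≡ w
  endOf-joins (inj₁ (p , q)) (inj₁ r) = inj₁ (trans (sym r) p)
  endOf-joins (inj₁ (p , q)) (inj₂ r) = inj₂ (trans (sym r) q)
  endOf-joins (inj₂ (p , q)) (inj₁ r) = inj₂ (trans (sym r) p)
  endOf-joins (inj₂ (p , q)) (inj₂ r) = inj₁ (trans (sym r) q)

  not-endOf : ∀ {e u w x} → Joins e u w → x ≢ u → x ≢ w → ¬ EndOf x e
  not-endOf e⟨u,w⟩ x≢u x≢w x∈e = [ x≢u , x≢w ]′ (endOf-joins e⟨u,w⟩ x∈e)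

  edges-differ : ∀ {a b p q r} → Joins a p q → EndOf r b → p ≢ r → q ≢ r → a ≢ b
  edges-differ a⟨p,q⟩ r∈b p≢r q≢r refl = not-endOf a⟨p,q⟩ (≢-sym p≢r) (≢-sym q≢r) r∈b

  same-ends : ∀ {e a b c d} → Joins e a b → Joins e c d → (a ≡ c × b ≡ d) ⊎ (a ≡ d × b ≡ c)
  same-ends (inj₁ (p , q)) (inj₁ (r , s)) = inj₁ (trans (sym p) r , trans (sym q) s)
  same-ends (inj₁ (p , q)) (inj₂ (r , s)) = inj₂ (trans (sym p) r , trans (sym q) s)
  same-ends (inj₂ (p , q)) (inj₁ (r , s)) = inj₂ (trans (sym q) s , trans (sym p) r)
  same-ends (inj₂ (p , q)) (inj₂ (r , s)) = inj₁ (trans (sym q) s , trans (sym p) r)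

  meets⇒common-end : ∀ {e f} → Meets G e f → ∃[ x ] (EndOf x e × EndOf x f)
  meets⇒common-end {e} (inj₁ p)               = end₁ G e , inj₁ refl , inj₁ (sym p)
  meets⇒common-end {e} (inj₂ (inj₁ p))        = end₁ G e , inj₁ refl , inj₂ (sym p)
  meets⇒common-end {e} (inj₂ (inj₂ (inj₁ p))) = end₂ G e , inj₂ refl , inj₁ (sym p)
  meets⇒common-end {e} (inj₂ (inj₂ (inj₂ p))) = end₂ G e , inj₂ refl , inj₂ (sym p)

  Incident : EdgeSet G → Vertex → Edge → Set
  Incident D v e = e ∈ D × EndOf v e

  degTerm : EdgeSet G → Vertex → Vector ℕ (m G)
  degTerm D v e = if lookup D e then endsAt G v e else 0

  deg≡∑ : ∀ D v → deg G D v ≡ ∑ (degTerm D v)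
  deg≡∑ D v = sum-map-tabulate id (degTerm D v)

  endsAt-positive : ∀ {v e} → EndOf v e → 1 ≤ endsAt G v e
  endsAt-positive {v} {e} v∈e with end₁ G e ≟ v | end₂ G e ≟ v | v∈e
  ... | yes _ | _     | _      = s≤s z≤n
  ... | no _  | yes _ | _      = s≤s z≤n
  ... | no ¬p | no _  | inj₁ p = ⊥-elim (¬p p)
  ... | no _  | no ¬q | inj₂ q = ⊥-elim (¬q q)

  endsAt-positive⁻ : ∀ {v e} → 1 ≤ endsAt G v e → EndOf v e
  endsAt-positive⁻ {v} {e} 1≤ends with end₁ G e ≟ v | end₂ G e ≟ v
  ... | yes p | _     = inj₁ p
  ... | no _  | yes q = inj₂ q

  degTerm-positive : ∀ {D v e} → Incident D v e → 1 ≤ degTerm D v e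
  degTerm-positive {D} {v} {e} (e∈D , v∈e) rewrite Vecₚ.[]=⇒lookup e∈D = endsAt-positive v∈e

  degTerm-positive⁻ : ∀ {D v e} → 1 ≤ degTerm D v e → Incident D v e
  degTerm-positive⁻ {D} {v} {e} 1≤term with lookup D e in eq
  ... | true = Vecₚ.lookup⇒[]= e D eq , endsAt-positive⁻ 1≤term

  degTerm-⊤ : ∀ v e → degTerm ⊤ v e ≡ endsAt G v e
  degTerm-⊤ v e rewrite Vecₚ.lookup-replicate e true = refl

  distinct-edges≤deg : ∀ {D v es} → Unique es → All (Incident D v) es → length es ≤ deg G D v
  distinct-edges≤deg {D} {v} uniq es-at-v =
    subst (_ ≤_) (sym (deg≡∑ D v)) (length≤∑ (degTerm D v) uniq (All.map degTerm-positive es-at-v))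

  some-edge : ∀ D v → 0 < deg G D v → ∃[ a ] Incident D v a
  some-edge D v 0<deg with ∑-positive (degTerm D v) (subst (0 <_) (deg≡∑ D v) 0<deg)
  ... | a , 0<term = a , degTerm-positive⁻ 0<term

  another-edge : ∀ D v {a} → degTerm D v a < deg G D v → ∃[ b ] (b ≢ a × Incident D v b)
  another-edge D v {a} a<deg with positive-besides (degTerm D v) a (subst (degTerm D v a <_) (deg≡∑ D v) a<deg)
  ... | b , b≢a , 0<term = b , b≢a , degTerm-positive⁻ 0<term

  lookup-⁅⁆ : ∀ (v x : Vertex) → lookup ⁅ v ⁆ x ≡ ⌊ x ≟ v ⌋
  lookup-⁅⁆ v x with x ≟ v
  ... | yes refl = Vecₚ.[]=⇒lookup (x∈⁅x⁆ x)
  ... | no x≢v   = ¬-not (x≢y⇒x∉⁅y⁆ x≢v ∘ Vecₚ.lookup⇒[]= x ⁅ v ⁆)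

  inCut-⁅⁆ : ∀ v e → inCut G ⁅ v ⁆ e ≡ true ⇔ endsAt G v e ≡ 1
  inCut-⁅⁆ v e rewrite lookup-⁅⁆ v (end₁ G e) | lookup-⁅⁆ v (end₂ G e)
    with end₁ G e ≟ v | end₂ G e ≟ v
  ... | yes _ | yes _ = mk⇔ (λ ()) (λ ())
  ... | yes _ | no _  = mk⇔ (λ _ → refl) (λ _ → refl)
  ... | no _  | yes _ = mk⇔ (λ _ → refl) (λ _ → refl)
  ... | no _  | no _  = mk⇔ (λ ()) (λ ())

  -- Two edges differ once one of them has an end that is not an end of the other; only for c₃ and c₄,
  -- whose far end v₅ is unconstrained, this has to be assumed.
  path-edges-distinct : ∀ {g c₁ c₂ c₃ c₄ u w v₂ v₃ v₄ v₅} → Unique (u ∷ w ∷ v₂ ∷ v₃ ∷ v₄ ∷ []) → c₃ ≢ c₄ →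
    Joins g u w → Joins c₁ w v₂ → Joins c₂ v₂ v₃ → Joins c₃ v₃ v₄ → Joins c₄ v₄ v₅ →
    Unique (g ∷ c₁ ∷ c₂ ∷ c₃ ∷ c₄ ∷ [])
  path-edges-distinct ((_ ∷ u≢v₂ ∷ u≢v₃ ∷ u≢v₄ ∷ []) ∷ (w≢v₂ ∷ w≢v₃ ∷ w≢v₄ ∷ []) ∷
                       (v₂≢v₃ ∷ v₂≢v₄ ∷ []) ∷ (v₃≢v₄ ∷ []) ∷ _)
                      c₃≢c₄ g⟨u,w⟩ c₁⟨w,v₂⟩ c₂⟨v₂,v₃⟩ c₃⟨v₃,v₄⟩ c₄⟨v₄,v₅⟩ =
      ( edges-differ g⟨u,w⟩ (joins-end₂ c₁⟨w,v₂⟩) u≢v₂ w≢v₂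
      ∷ edges-differ g⟨u,w⟩ (joins-end₂ c₂⟨v₂,v₃⟩) u≢v₃ w≢v₃
      ∷ edges-differ g⟨u,w⟩ (joins-end₂ c₃⟨v₃,v₄⟩) u≢v₄ w≢v₄
      ∷ edges-differ g⟨u,w⟩ (joins-end₁ c₄⟨v₄,v₅⟩) u≢v₄ w≢v₄ ∷ [])
    ∷ ( edges-differ c₁⟨w,v₂⟩ (joins-end₂ c₂⟨v₂,v₃⟩) w≢v₃ v₂≢v₃
      ∷ edges-differ c₁⟨w,v₂⟩ (joins-end₂ c₃⟨v₃,v₄⟩) w≢v₄ v₂≢v₄
      ∷ edges-differ c₁⟨w,v₂⟩ (joins-end₁ c₄⟨v₄,v₅⟩) w≢v₄ v₂≢v₄ ∷ [])
    ∷ ( edges-differ c₂⟨v₂,v₃⟩ (joins-end₂ c₃⟨v₃,v₄⟩) v₂≢v₄ v₃≢v₄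
      ∷ edges-differ c₂⟨v₂,v₃⟩ (joins-end₁ c₄⟨v₄,v₅⟩) v₂≢v₄ v₃≢v₄ ∷ [])
    ∷ (c₃≢c₄ ∷ [])
    ∷ [] ∷ []

  record FiveCycle (D : EdgeSet G) (g : Edge) (u w : Vertex) : Set where
    field
      v₂ v₃ v₄ : Vertex
      e₁ e₂ e₃ e₄ : Edge

    vertices : List Vertex
    vertices = u ∷ w ∷ v₂ ∷ v₃ ∷ v₄ ∷ []

    edges : List Edge
    edges = g ∷ e₁ ∷ e₂ ∷ e₃ ∷ e₄ ∷ []

    vertex : Fin 5 → Vertex
    vertex = List.lookup vertices

    edge : Fin 5 → Edge
    edge = List.lookup edges

    field
      joins             : ∀ i → Joins (edge i) (vertex i) (vertex (cyclicSuc i))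
      vertices-distinct : Unique vertices
      edges-distinct    : Unique edges
      edges⊆D           : All (_∈ D) edges
      D⊆edges           : ∀ {f} → f ∈ D → f ∈ˡ edges

    edge∈D : ∀ i → edge i ∈ D
    edge∈D i = All.lookup edges⊆D (∈-lookup i)

    distinct-edges : ∀ {i j} → i ≢ j → edge i ≢ edge j
    distinct-edges i≢j = i≢j ∘ lookup-injective edges-distinct

    vertex-incident : ∀ {x} → x ∈ˡ vertices → ∃[ e ] Incident D x e
    vertex-incident x∈ with ∈⇒lookup x∈
    ... | i , refl = edge i , edge∈D i , joins-end₁ (joins i)

  Loopless : Set
  Loopless = ∀ e → end₁ G e ≢ end₂ G e

  -- At a loop ℓ the cubic degree leaves room for exactly one further edge e, and then ∂({v}) = {e}.
  cubic-bridgeless⇒loopless : Cubic G → Bridgeless G → Loopless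
  cubic-bridgeless⇒loopless cubic bridgeless ℓ loop =
    bridgeless e (⁅ v ⁆ , λ f → cut⇒e f , λ { refl → Equivalence.from (inCut-⁅⁆ v e) h[e]≡1 })
    where
    v : Vertex
    v = end₁ G ℓ
    h : Vector ℕ (m G)
    h = degTerm ⊤ v
    h[ℓ]≡2 : h ℓ ≡ 2
    h[ℓ]≡2 rewrite degTerm-⊤ v ℓ | loop with end₂ G ℓ ≟ end₂ G ℓ
    ... | yes _  = refl
    ... | no ¬eq = ⊥-elim (¬eq refl)
    sum≤3 : ∀ {es} → Unique es → ListSum.sum (map h es) ≤ 3
    sum≤3 {es} uniq =
      subst (ListSum.sum (map h es) ≤_) (trans (sym (deg≡∑ ⊤ v)) (cubic v)) (sum-distinct≤∑ h uniq)
    other : ∃[ e ] (e ≢ ℓ × Incident ⊤ v e)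
    other = another-edge ⊤ v (subst₂ _<_ (sym h[ℓ]≡2) (sym (cubic v)) ≤-refl)
    e : Edge
    e = proj₁ other
    e≢ℓ : e ≢ ℓ
    e≢ℓ = proj₁ (proj₂ other)
    1≤h[e] : 1 ≤ h e
    1≤h[e] = degTerm-positive (proj₂ (proj₂ other))
    h[e]≤1 : h e ≤ 1
    h[e]≤1 = +-cancelˡ-≤ 2 (h e) 1
      (subst₂ (λ k l → k + l ≤ 3) h[ℓ]≡2 (+-identityʳ (h e)) (sum≤3 ((≢-sym e≢ℓ ∷ []) ∷ [] ∷ [])))
    h[e]≡1 : endsAt G v e ≡ 1
    h[e]≡1 = trans (sym (degTerm-⊤ v e)) (≤-antisym h[e]≤1 1≤h[e])
    cut⇒e : ∀ f → inCut G ⁅ v ⁆ f ≡ true → f ≡ e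
    cut⇒e f f∈cut with f ≟ e
    ... | yes f≡e = f≡e
    ... | no f≢e  = ⊥-elim (<-irrefl refl 4≤3)
      where
      h[f]≡1 : h f ≡ 1
      h[f]≡1 = trans (degTerm-⊤ v f) (Equivalence.to (inCut-⁅⁆ v f) f∈cut)
      f≢ℓ : f ≢ ℓ
      f≢ℓ refl with () ← trans (sym h[ℓ]≡2) h[f]≡1
      4≤3 : 4 ≤ 3
      4≤3 = ≤-trans (+-mono-≤ (≤-reflexive (sym h[ℓ]≡2))
                      (+-mono-≤ 1≤h[e] (+-mono-≤ (≤-reflexive (sym h[f]≡1)) z≤n)))
                    (sum≤3 ((≢-sym e≢ℓ ∷ ≢-sym f≢ℓ ∷ []) ∷ (≢-sym f≢e ∷ []) ∷ [] ∷ []))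

module LooplessGraph (G : Graph) (loopless : Incidence.Loopless G) where
  open Incidence G

  joins-distinct : ∀ {e u w} → Joins e u w → u ≢ w
  joins-distinct {e} (inj₁ (p , q)) refl = loopless e (trans p (sym q))
  joins-distinct {e} (inj₂ (p , q)) refl = loopless e (trans p (sym q))

  joins-functional : ∀ {e u w w′} → Joins e u w → Joins e u w′ → w ≡ w′
  joins-functional e⟨u,w⟩ e⟨u,w′⟩ with same-ends e⟨u,w⟩ e⟨u,w′⟩
  ... | inj₁ (_ , w≡w′)  = w≡w′
  ... | inj₂ (_ , w≡u)    = ⊥-elim (joins-distinct e⟨u,w⟩ (sym w≡u))

  degTerm≤1 : ∀ D v e → degTerm D v e ≤ 1
  degTerm≤1 D v e with lookup D e | end₁ G e ≟ v | end₂ G e ≟ v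
  ... | false | _      | _     = z≤n
  ... | true  | yes p  | yes q = ⊥-elim (loopless e (trans p (sym q)))
  ... | true  | yes _  | no _  = ≤-refl
  ... | true  | no _   | yes _ = ≤-refl
  ... | true  | no _   | no _  = z≤n

  module CircuitProperties (D : EdgeSet G) (circuit : Circuit G D) where

    deg≡2 : ∀ {v e} → Incident D v e → deg G D v ≡ 2
    deg≡2 {v} e-at-v with proj₁ (proj₂ circuit) v
    ... | inj₂ deg≡2 = deg≡2
    ... | inj₁ deg≡0 with () ← subst (1 ≤_) deg≡0 (distinct-edges≤deg ([] ∷ []) (e-at-v ∷ []))

    next-edge : ∀ {v e} → Incident D v e → ∃[ e′ ] (e′ ≢ e × Incident D v e′)
    next-edge {v} {e} e-at-v =
      another-edge D v (subst (degTerm D v e <_) (sym (deg≡2 e-at-v)) (s≤s (degTerm≤1 D v e)))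

    no-three-edges : ∀ {v a b c} → Unique (a ∷ b ∷ c ∷ []) → All (Incident D v) (a ∷ b ∷ c ∷ []) → ⊥
    no-three-edges uniq all@(a-at-v ∷ _) =
      <-irrefl refl (subst (3 ≤_) (deg≡2 a-at-v) (distinct-edges≤deg uniq all))

    third-edge : ∀ {v a b f} → a ≢ b → Incident D v a → Incident D v b → Incident D v f → f ≡ a ⊎ f ≡ b
    third-edge {a = a} {b} {f} a≢b a-at-v b-at-v f-at-v with f ≟ a | f ≟ b
    ... | yes f≡a | _       = inj₁ f≡a
    ... | no _    | yes f≡b = inj₂ f≡b
    ... | no f≢a  | no f≢b  =
      ⊥-elim (no-three-edges ((a≢b ∷ ≢-sym f≢a ∷ []) ∷ (≢-sym f≢b ∷ []) ∷ [] ∷ [])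
                             (a-at-v ∷ b-at-v ∷ f-at-v ∷ []))

    second-vertex : ∀ {g u w k x} (c : FiveCycle D g u w) → k ∈ D → k ≢ g → Joins k w x →
      FiveCycle.v₂ c ≡ x
    second-vertex c k∈D k≢g k⟨w,x⟩
      with third-edge (FiveCycle.distinct-edges c {0F} {1F} (λ ()))
             (FiveCycle.edge∈D c 0F , joins-end₂ (FiveCycle.joins c 0F))
             (FiveCycle.edge∈D c 1F , joins-end₁ (FiveCycle.joins c 1F)) (k∈D , joins-end₁ k⟨w,x⟩)
    ... | inj₁ k≡g  = ⊥-elim (k≢g k≡g)
    ... | inj₂ refl = joins-functional (FiveCycle.joins c 1F) k⟨w,x⟩

    ClosedList : List Edge → Set
    ClosedList xs = ∀ {x e f} → e ∈ˡ xs → EndOf x e → Incident D x f → f ∈ˡ xs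

    closed-list-covers : ∀ xs {x₀} → x₀ ∈ˡ xs → All (_∈ D) xs → ClosedList xs → ∀ {f} → f ∈ D → f ∈ˡ xs
    closed-list-covers xs x₀∈xs xs⊆D closed {f} f∈D with f ∈ˡ? xs
    ... | yes f∈xs = f∈xs
    ... | no f∉xs with proj₂ (proj₂ circuit) (fromList xs) (All.lookup xs⊆D ∘ ∈-fromList⁻)
                         (_ , ∈-fromList⁺ x₀∈xs) (f , f∈D , f∉xs ∘ ∈-fromList⁻)
    ...   | e , f′ , e∈X , f′∈D , f′∉X , e-meets-f′ with meets⇒common-end e-meets-f′
    ...     | x , x∈e , x∈f′ =
      ⊥-elim (f′∉X (∈-fromList⁺ (closed (∈-fromList⁻ e∈X) x∈e (f′∈D , x∈f′))))

    record Continuation (e : Edge) (y : Vertex) : Set where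
      field
        next        : Edge
        far         : Vertex
        next≢e      : next ≢ e
        next∈D      : next ∈ D
        next⟨y,far⟩ : Joins next y far

    continue : ∀ {e x y} → e ∈ D → Joins e x y → Continuation e y
    continue e∈D e⟨x,y⟩ with next-edge (e∈D , joins-end₂ e⟨x,y⟩)
    ... | e′ , e′≢e , e′∈D , y∈e′ =
      let z , e′⟨y,z⟩ = joins-other-end y∈e′ in
      record { next = e′ ; far = z ; next≢e = e′≢e ; next∈D = e′∈D ; next⟨y,far⟩ = e′⟨y,z⟩ }

  module FiveCircuitProperties (D : EdgeSet G) (five : Circuit5 G D) where
    open CircuitProperties D (proj₁ five)

    ∣D∣≡5 : ∣ D ∣ ≡ 5
    ∣D∣≡5 = proj₂ five

    no-short-closed-list : ∀ xs {x₀} → length xs < 5 → x₀ ∈ˡ xs → All (_∈ D) xs → ClosedList xs → ⊥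
    no-short-closed-list xs len<5 x₀∈xs xs⊆D closed =
      <-irrefl refl (<-≤-trans len<5 (subst (_≤ length xs) ∣D∣≡5
        (∣p∣≤length xs (closed-list-covers xs x₀∈xs xs⊆D closed))))

    five-distinct-edges-cover : ∀ es → length es ≡ 5 → Unique es → All (_∈ D) es →
      ∀ {f} → f ∈ D → f ∈ˡ es
    five-distinct-edges-cover es len≡5 uniq es⊆D {f} f∈D with f ∈ˡ? es
    ... | yes f∈es = f∈es
    ... | no f∉es  = ⊥-elim (<-irrefl refl (subst₂ _≤_ (cong suc len≡5) ∣D∣≡5
                       (length≤∣p∣ (¬Any⇒All¬ es f∉es ∷ uniq) (f∈D ∷ es⊆D))))

    listed-at : ∀ {xs x a b f} → a ≢ b → Incident D x a → Incident D x b → a ∈ˡ xs → b ∈ˡ xs →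
      Incident D x f → f ∈ˡ xs
    listed-at a≢b a-at b-at a∈xs b∈xs f-at with third-edge a≢b a-at b-at f-at
    ... | inj₁ refl = a∈xs
    ... | inj₂ refl = b∈xs

    edge-closed : ∀ {xs e p q} → Joins e p q → (∀ {f} → Incident D p f → f ∈ˡ xs) →
      (∀ {f} → Incident D q f → f ∈ˡ xs) → ∀ {x f} → EndOf x e → Incident D x f → f ∈ˡ xs
    edge-closed e⟨p,q⟩ at-p at-q x∈e with endOf-joins e⟨p,q⟩ x∈e
    ... | inj₁ refl = at-p
    ... | inj₂ refl = at-q

    no-2-cycle : ∀ {g c₁ u w} → g ≢ c₁ → g ∈ D → c₁ ∈ D → Joins g u w → Joins c₁ w u → ⊥
    no-2-cycle {g} {c₁} {u} {w} g≢c₁ g∈D c₁∈D g⟨u,w⟩ c₁⟨w,u⟩ =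
      no-short-closed-list xs (s≤s (s≤s (s≤s z≤n))) (here refl) (g∈D ∷ c₁∈D ∷ []) closed
      where
      xs = g ∷ c₁ ∷ []
      at-u : ∀ {f} → Incident D u f → f ∈ˡ xs
      at-u = listed-at g≢c₁ (g∈D , joins-end₁ g⟨u,w⟩) (c₁∈D , joins-end₂ c₁⟨w,u⟩) (here refl) (there (here refl))
      at-w : ∀ {f} → Incident D w f → f ∈ˡ xs
      at-w = listed-at g≢c₁ (g∈D , joins-end₂ g⟨u,w⟩) (c₁∈D , joins-end₁ c₁⟨w,u⟩) (here refl) (there (here refl))
      closed : ClosedList xs
      closed (here refl)         = edge-closed g⟨u,w⟩ at-u at-w
      closed (there (here refl)) = edge-closed c₁⟨w,u⟩ at-w at-u

    no-3-cycle : ∀ {g c₁ c₂ u w v₂} → g ≢ c₁ → g ≢ c₂ → c₁ ≢ c₂ → g ∈ D → c₁ ∈ D → c₂ ∈ D →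
      Joins g u w → Joins c₁ w v₂ → Joins c₂ v₂ u → ⊥
    no-3-cycle {g} {c₁} {c₂} {u} {w} {v₂} g≢c₁ g≢c₂ c₁≢c₂ g∈D c₁∈D c₂∈D g⟨u,w⟩ c₁⟨w,v₂⟩ c₂⟨v₂,u⟩ =
      no-short-closed-list xs (s≤s (s≤s (s≤s (s≤s z≤n)))) (here refl) (g∈D ∷ c₁∈D ∷ c₂∈D ∷ []) closed
      where
      xs = g ∷ c₁ ∷ c₂ ∷ []
      at-u : ∀ {f} → Incident D u f → f ∈ˡ xs
      at-u = listed-at g≢c₂ (g∈D , joins-end₁ g⟨u,w⟩) (c₂∈D , joins-end₂ c₂⟨v₂,u⟩)
               (here refl) (there (there (here refl)))
      at-w : ∀ {f} → Incident D w f → f ∈ˡ xs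
      at-w = listed-at g≢c₁ (g∈D , joins-end₂ g⟨u,w⟩) (c₁∈D , joins-end₁ c₁⟨w,v₂⟩)
               (here refl) (there (here refl))
      at-v₂ : ∀ {f} → Incident D v₂ f → f ∈ˡ xs
      at-v₂ = listed-at c₁≢c₂ (c₁∈D , joins-end₂ c₁⟨w,v₂⟩) (c₂∈D , joins-end₁ c₂⟨v₂,u⟩)
                (there (here refl)) (there (there (here refl)))
      closed : ClosedList xs
      closed (here refl)                 = edge-closed g⟨u,w⟩ at-u at-w
      closed (there (here refl))         = edge-closed c₁⟨w,v₂⟩ at-w at-v₂
      closed (there (there (here refl))) = edge-closed c₂⟨v₂,u⟩ at-v₂ at-u

    no-4-cycle : ∀ {g c₁ c₂ c₃ u w v₂ v₃} → g ≢ c₁ → g ≢ c₃ → c₁ ≢ c₂ → c₂ ≢ c₃ →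
      g ∈ D → c₁ ∈ D → c₂ ∈ D → c₃ ∈ D →
      Joins g u w → Joins c₁ w v₂ → Joins c₂ v₂ v₃ → Joins c₃ v₃ u → ⊥
    no-4-cycle {g} {c₁} {c₂} {c₃} {u} {w} {v₂} {v₃} g≢c₁ g≢c₃ c₁≢c₂ c₂≢c₃ g∈D c₁∈D c₂∈D c₃∈D
               g⟨u,w⟩ c₁⟨w,v₂⟩ c₂⟨v₂,v₃⟩ c₃⟨v₃,u⟩ =
      no-short-closed-list xs ≤-refl (here refl) (g∈D ∷ c₁∈D ∷ c₂∈D ∷ c₃∈D ∷ []) closed
      where
      xs = g ∷ c₁ ∷ c₂ ∷ c₃ ∷ []
      at-u : ∀ {f} → Incident D u f → f ∈ˡ xs
      at-u = listed-at g≢c₃ (g∈D , joins-end₁ g⟨u,w⟩) (c₃∈D , joins-end₂ c₃⟨v₃,u⟩)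
               (here refl) (there (there (there (here refl))))
      at-w : ∀ {f} → Incident D w f → f ∈ˡ xs
      at-w = listed-at g≢c₁ (g∈D , joins-end₂ g⟨u,w⟩) (c₁∈D , joins-end₁ c₁⟨w,v₂⟩)
               (here refl) (there (here refl))
      at-v₂ : ∀ {f} → Incident D v₂ f → f ∈ˡ xs
      at-v₂ = listed-at c₁≢c₂ (c₁∈D , joins-end₂ c₁⟨w,v₂⟩) (c₂∈D , joins-end₁ c₂⟨v₂,v₃⟩)
                (there (here refl)) (there (there (here refl)))
      at-v₃ : ∀ {f} → Incident D v₃ f → f ∈ˡ xs
      at-v₃ = listed-at c₂≢c₃ (c₂∈D , joins-end₂ c₂⟨v₂,v₃⟩) (c₃∈D , joins-end₁ c₃⟨v₃,u⟩)
                (there (there (here refl))) (there (there (there (here refl))))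
      closed : ClosedList xs
      closed (here refl)                         = edge-closed g⟨u,w⟩ at-u at-w
      closed (there (here refl))                 = edge-closed c₁⟨w,v₂⟩ at-w at-v₂
      closed (there (there (here refl)))         = edge-closed c₂⟨v₂,v₃⟩ at-v₂ at-v₃
      closed (there (there (there (here refl)))) = edge-closed c₃⟨v₃,u⟩ at-v₃ at-u

    path-vertices-distinct : ∀ {g c₁ c₂ c₃ u w v₂ v₃ v₄} → g ∈ D → c₁ ∈ D → c₂ ∈ D → c₃ ∈ D →
      c₁ ≢ g → c₂ ≢ c₁ → c₃ ≢ c₂ → Joins g u w → Joins c₁ w v₂ → Joins c₂ v₂ v₃ → Joins c₃ v₃ v₄ →
      Unique (u ∷ w ∷ v₂ ∷ v₃ ∷ v₄ ∷ [])
    path-vertices-distinct {g} {c₁} {c₂} {c₃} {u} {w} {v₂} {v₃} {v₄} g∈D c₁∈D c₂∈D c₃∈D c₁≢g c₂≢c₁ c₃≢c₂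
                           g⟨u,w⟩ c₁⟨w,v₂⟩ c₂⟨v₂,v₃⟩ c₃⟨v₃,v₄⟩ =
      (u≢w ∷ u≢v₂ ∷ u≢v₃ ∷ u≢v₄ ∷ []) ∷ (w≢v₂ ∷ w≢v₃ ∷ w≢v₄ ∷ []) ∷ (v₂≢v₃ ∷ v₂≢v₄ ∷ []) ∷
      (v₃≢v₄ ∷ []) ∷ [] ∷ []
      where
      u≢w : u ≢ w
      u≢w = joins-distinct g⟨u,w⟩
      w≢v₂ : w ≢ v₂
      w≢v₂ = joins-distinct c₁⟨w,v₂⟩
      v₂≢v₃ : v₂ ≢ v₃
      v₂≢v₃ = joins-distinct c₂⟨v₂,v₃⟩
      v₃≢v₄ : v₃ ≢ v₄
      v₃≢v₄ = joins-distinct c₃⟨v₃,v₄⟩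
      g≢c₁ : g ≢ c₁
      g≢c₁ = ≢-sym c₁≢g
      c₁≢c₂ : c₁ ≢ c₂
      c₁≢c₂ = ≢-sym c₂≢c₁
      c₂≢c₃ : c₂ ≢ c₃
      c₂≢c₃ = ≢-sym c₃≢c₂
      u≢v₂ : u ≢ v₂
      u≢v₂ u≡v₂ = no-2-cycle g≢c₁ g∈D c₁∈D g⟨u,w⟩ (subst (Joins c₁ w) (sym u≡v₂) c₁⟨w,v₂⟩)
      g≢c₂ : g ≢ c₂
      g≢c₂ = edges-differ g⟨u,w⟩ (joins-end₁ c₂⟨v₂,v₃⟩) u≢v₂ w≢v₂
      w≢v₃ : w ≢ v₃
      w≢v₃ w≡v₃ = no-three-edges ((g≢c₁ ∷ g≢c₂ ∷ []) ∷ (c₁≢c₂ ∷ []) ∷ [] ∷ [])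
        ((g∈D , joins-end₂ g⟨u,w⟩) ∷ (c₁∈D , joins-end₁ c₁⟨w,v₂⟩) ∷
         (c₂∈D , subst (λ x → EndOf x c₂) (sym w≡v₃) (joins-end₂ c₂⟨v₂,v₃⟩)) ∷ [])
      u≢v₃ : u ≢ v₃
      u≢v₃ u≡v₃ = no-3-cycle g≢c₁ g≢c₂ c₁≢c₂ g∈D c₁∈D c₂∈D g⟨u,w⟩ c₁⟨w,v₂⟩
                    (subst (Joins c₂ v₂) (sym u≡v₃) c₂⟨v₂,v₃⟩)
      g≢c₃ : g ≢ c₃
      g≢c₃ = edges-differ g⟨u,w⟩ (joins-end₁ c₃⟨v₃,v₄⟩) u≢v₃ w≢v₃
      c₁≢c₃ : c₁ ≢ c₃
      c₁≢c₃ = edges-differ c₁⟨w,v₂⟩ (joins-end₁ c₃⟨v₃,v₄⟩) w≢v₃ v₂≢v₃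
      v₂≢v₄ : v₂ ≢ v₄
      v₂≢v₄ v₂≡v₄ = no-three-edges ((c₁≢c₂ ∷ c₁≢c₃ ∷ []) ∷ (c₂≢c₃ ∷ []) ∷ [] ∷ [])
        ((c₁∈D , joins-end₂ c₁⟨w,v₂⟩) ∷ (c₂∈D , joins-end₁ c₂⟨v₂,v₃⟩) ∷
         (c₃∈D , subst (λ x → EndOf x c₃) (sym v₂≡v₄) (joins-end₂ c₃⟨v₃,v₄⟩)) ∷ [])
      w≢v₄ : w ≢ v₄
      w≢v₄ w≡v₄ = no-three-edges ((g≢c₁ ∷ g≢c₃ ∷ []) ∷ (c₁≢c₃ ∷ []) ∷ [] ∷ [])
        ((g∈D , joins-end₂ g⟨u,w⟩) ∷ (c₁∈D , joins-end₁ c₁⟨w,v₂⟩) ∷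
         (c₃∈D , subst (λ x → EndOf x c₃) (sym w≡v₄) (joins-end₂ c₃⟨v₃,v₄⟩)) ∷ [])
      u≢v₄ : u ≢ v₄
      u≢v₄ u≡v₄ = no-4-cycle g≢c₁ g≢c₃ c₁≢c₂ c₂≢c₃ g∈D c₁∈D c₂∈D c₃∈D g⟨u,w⟩ c₁⟨w,v₂⟩ c₂⟨v₂,v₃⟩
                    (subst (Joins c₃ v₃) (sym u≡v₄) c₃⟨v₃,v₄⟩)

    -- The second D-edge at u can only be c₄, so the walk closes up at u.
    closing-vertex : ∀ {f g c₁ c₂ c₃ c₄ u w v₂ v₃ v₄ v₅} → f ∈ˡ (g ∷ c₁ ∷ c₂ ∷ c₃ ∷ c₄ ∷ []) → f ≢ g →
      EndOf u f → Unique (u ∷ w ∷ v₂ ∷ v₃ ∷ v₄ ∷ []) →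
      Joins c₁ w v₂ → Joins c₂ v₂ v₃ → Joins c₃ v₃ v₄ → Joins c₄ v₄ v₅ → v₅ ≡ u
    closing-vertex (here f≡g) f≢g _ _ _ _ _ _ = ⊥-elim (f≢g f≡g)
    closing-vertex (there (here refl)) _ u∈f ((u≢w ∷ u≢v₂ ∷ _) ∷ _) c₁⟨w,v₂⟩ _ _ _ =
      ⊥-elim (not-endOf c₁⟨w,v₂⟩ u≢w u≢v₂ u∈f)
    closing-vertex (there (there (here refl))) _ u∈f ((_ ∷ u≢v₂ ∷ u≢v₃ ∷ _) ∷ _) _ c₂⟨v₂,v₃⟩ _ _ =
      ⊥-elim (not-endOf c₂⟨v₂,v₃⟩ u≢v₂ u≢v₃ u∈f)
    closing-vertex (there (there (there (here refl)))) _ u∈f ((_ ∷ _ ∷ u≢v₃ ∷ u≢v₄ ∷ _) ∷ _) _ _ c₃⟨v₃,v₄⟩ _ =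
      ⊥-elim (not-endOf c₃⟨v₃,v₄⟩ u≢v₃ u≢v₄ u∈f)
    closing-vertex (there (there (there (there (here refl))))) _ u∈f ((_ ∷ _ ∷ _ ∷ u≢v₄ ∷ _) ∷ _) _ _ _ c₄⟨v₄,v₅⟩
      with endOf-joins c₄⟨v₄,v₅⟩ u∈f
    ... | inj₁ u≡v₄ = ⊥-elim (u≢v₄ u≡v₄)
    ... | inj₂ u≡v₅ = sym u≡v₅

    build : ∀ {g u w} → g ∈ D → Joins g u w → FiveCycle D g u w
    build {g} {u} {w} g∈D g⟨u,w⟩ = record
      { v₂ = v₂ ; v₃ = v₃ ; v₄ = v₄ ; e₁ = c₁ ; e₂ = c₂ ; e₃ = c₃ ; e₄ = c₄
      ; joins             = λ { 0F → g⟨u,w⟩ ; 1F → c₁⟨w,v₂⟩ ; 2F → c₂⟨v₂,v₃⟩ ; 3F → c₃⟨v₃,v₄⟩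
                              ; 4F → c₄⟨v₄,u⟩ }
      ; vertices-distinct = vertices-distinct
      ; edges-distinct    = edges-distinct
      ; edges⊆D           = edges⊆D
      ; D⊆edges           = D⊆edges
      }
      where
      open Continuation (continue g∈D g⟨u,w⟩)
        renaming (next to c₁; far to v₂; next≢e to c₁≢g; next∈D to c₁∈D; next⟨y,far⟩ to c₁⟨w,v₂⟩)
      open Continuation (continue c₁∈D c₁⟨w,v₂⟩)
        renaming (next to c₂; far to v₃; next≢e to c₂≢c₁; next∈D to c₂∈D; next⟨y,far⟩ to c₂⟨v₂,v₃⟩)
      open Continuation (continue c₂∈D c₂⟨v₂,v₃⟩)
        renaming (next to c₃; far to v₄; next≢e to c₃≢c₂; next∈D to c₃∈D; next⟨y,far⟩ to c₃⟨v₃,v₄⟩)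
      open Continuation (continue c₃∈D c₃⟨v₃,v₄⟩)
        renaming (next to c₄; far to v₅; next≢e to c₄≢c₃; next∈D to c₄∈D; next⟨y,far⟩ to c₄⟨v₄,v₅⟩)

      vertices-distinct : Unique (u ∷ w ∷ v₂ ∷ v₃ ∷ v₄ ∷ [])
      vertices-distinct = path-vertices-distinct g∈D c₁∈D c₂∈D c₃∈D c₁≢g c₂≢c₁ c₃≢c₂
                            g⟨u,w⟩ c₁⟨w,v₂⟩ c₂⟨v₂,v₃⟩ c₃⟨v₃,v₄⟩
      edges-distinct : Unique (g ∷ c₁ ∷ c₂ ∷ c₃ ∷ c₄ ∷ [])
      edges-distinct = path-edges-distinct vertices-distinct (≢-sym c₄≢c₃)
                         g⟨u,w⟩ c₁⟨w,v₂⟩ c₂⟨v₂,v₃⟩ c₃⟨v₃,v₄⟩ c₄⟨v₄,v₅⟩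
      edges⊆D : All (_∈ D) (g ∷ c₁ ∷ c₂ ∷ c₃ ∷ c₄ ∷ [])
      edges⊆D = g∈D ∷ c₁∈D ∷ c₂∈D ∷ c₃∈D ∷ c₄∈D ∷ []
      D⊆edges : ∀ {f} → f ∈ D → f ∈ˡ (g ∷ c₁ ∷ c₂ ∷ c₃ ∷ c₄ ∷ [])
      D⊆edges = five-distinct-edges-cover _ refl edges-distinct edges⊆D
      c₄⟨v₄,u⟩ : Joins c₄ v₄ u
      c₄⟨v₄,u⟩ = let f , f≢g , f∈D , u∈f = next-edge (g∈D , joins-end₁ g⟨u,w⟩) in
        subst (Joins c₄ v₄) (closing-vertex (D⊆edges f∈D) f≢g u∈f vertices-distinct
                               c₁⟨w,v₂⟩ c₂⟨v₂,v₃⟩ c₃⟨v₃,v₄⟩ c₄⟨v₄,v₅⟩)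
          c₄⟨v₄,v₅⟩

-- Circuits of a 2-factor and copies of S

CommonCopyOfS : (G : Graph) → EdgeSet G → EdgeSet G → Set
CommonCopyOfS G P Q = Σ (Embedding S G) (λ emb → ContainedIn emb P × ContainedIn emb Q)

common-copy-sym : ∀ {G P Q} → CommonCopyOfS G P Q → CommonCopyOfS G Q P
common-copy-sym (emb , P⊆emb , Q⊆emb) = emb , Q⊆emb , P⊆emb

module TwoFactorProperties (G : Graph) (cubic : Cubic G) (loopless : Incidence.Loopless G)
                           (F : EdgeSet G) (two-factor : TwoFactor G F) where
  open Incidence G
  open LooplessGraph G loopless

  absorbs : ∀ {Y x a b} → CircuitOf G F Y → Incident Y x a → Incident F x b → b ∈ Y
  absorbs {Y} {x} {a} {b} (Y-circuit , Y⊆F) a-at-x@(a∈Y , x∈a) b-at-x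
    with b ∈? Y | CircuitProperties.next-edge Y Y-circuit a-at-x
  ... | yes b∈Y | _ = b∈Y
  ... | no b∉Y  | a′ , a′≢a , a′∈Y , x∈a′ =
    ⊥-elim (<-irrefl refl (subst (3 ≤_) (two-factor x)
      (distinct-edges≤deg ((≢-sym a′≢a ∷ ≢b a∈Y ∷ []) ∷ (≢b a′∈Y ∷ []) ∷ [] ∷ [])
                          ((Y⊆F a∈Y , x∈a) ∷ (Y⊆F a′∈Y , x∈a′) ∷ b-at-x ∷ []))))
    where
    ≢b : ∀ {e} → e ∈ Y → e ≢ b
    ≢b e∈Y refl = b∉Y e∈Y

  circuit⊆circuit-sharing-edge : ∀ {Y Z e} → CircuitOf G F Y → CircuitOf G F Z → e ∈ Y → e ∈ Z → Y ⊆ Z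
  circuit⊆circuit-sharing-edge {Y} {Z} {e} Y-circuit@((_ , _ , Y-connected) , Y⊆F) Z-circuit e∈Y e∈Z {f} f∈Y
    with f ∈? Z
  ... | yes f∈Z = f∈Z
  ... | no f∉Z
    with Y-connected (Y ∩ Z) (p∩q⊆p Y Z) (e , x∈p∩q⁺ (e∈Y , e∈Z)) (f , f∈Y , f∉Z ∘ proj₂ ∘ x∈p∩q⁻ Y Z)
  ...   | e′ , f′ , e′∈Y∩Z , f′∈Y , f′∉Y∩Z , e′-meets-f′ with meets⇒common-end e′-meets-f′
  ...     | x , x∈e′ , x∈f′ = ⊥-elim (f′∉Y∩Z (x∈p∩q⁺ (f′∈Y , f′∈Z)))
    where
    f′∈Z : f′ ∈ Z
    f′∈Z = absorbs Z-circuit (proj₂ (x∈p∩q⁻ Y Z e′∈Y∩Z) , x∈e′) (proj₂ Y-circuit f′∈Y , x∈f′)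

  circuits-sharing-edge-equal : ∀ {Y Z e} → CircuitOf G F Y → CircuitOf G F Z → e ∈ Y → e ∈ Z → Y ≡ Z
  circuits-sharing-edge-equal Y-circuit Z-circuit e∈Y e∈Z =
    ⊆-antisym (circuit⊆circuit-sharing-edge Y-circuit Z-circuit e∈Y e∈Z)
              (circuit⊆circuit-sharing-edge Z-circuit Y-circuit e∈Z e∈Y)

  distinct-circuits-vertex-disjoint : ∀ {Y Z x a b} → CircuitOf G F Y → CircuitOf G F Z → Y ≢ Z →
    Incident Y x a → Incident Z x b → ⊥
  distinct-circuits-vertex-disjoint Y-circuit Z-circuit Y≢Z a-at-x b-at-x@(b∈Z , x∈b) =
    Y≢Z (circuits-sharing-edge-equal Y-circuit Z-circuit
           (absorbs Y-circuit a-at-x (proj₂ Z-circuit b∈Z , x∈b)) b∈Z)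

  -- F uses two of the three edges at every vertex, leaving room for only one non-F edge.
  non-F-edges-not-adjacent : ∀ {x p q} → p ∉ F → q ∉ F → p ≢ q → EndOf x p → EndOf x q → ⊥
  non-F-edges-not-adjacent {x} {p} {q} p∉F q∉F p≢q x∈p x∈q
    with some-edge F x (subst (0 <_) (sym (two-factor x)) (s≤s z≤n))
  ... | a , a-at-x@(a∈F , x∈a)
    with another-edge F x {a} (subst (degTerm F x a <_) (sym (two-factor x)) (s≤s (degTerm≤1 F x a)))
  ...   | b , b≢a , b∈F , x∈b =
    <-irrefl refl (subst (4 ≤_) (cubic x) (distinct-edges≤deg
      ((≢-sym b≢a ∷ ≢ a∈F p∉F ∷ ≢ a∈F q∉F ∷ []) ∷ (≢ b∈F p∉F ∷ ≢ b∈F q∉F ∷ []) ∷ (p≢q ∷ []) ∷ [] ∷ [])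
      ((∈⊤ , x∈a) ∷ (∈⊤ , x∈b) ∷ (∈⊤ , x∈p) ∷ (∈⊤ , x∈q) ∷ [])))
    where
    ≢ : ∀ {e e′} → e ∈ F → e′ ∉ F → e ≢ e′
    ≢ e∈F e′∉F refl = e′∉F e∈F

  module _ {P Q gP gQ a₁ a₂ b₁ b₂ g h}
           (P-circuit : CircuitOf G F P) (Q-circuit : CircuitOf G F Q) (P≢Q : P ≢ Q)
           (cp : FiveCycle P gP a₁ a₂) (cq : FiveCycle Q gQ b₁ b₂) (g∉F : g ∉ F) (h∉F : h ∉ F)
           (g⟨a₂,b₁⟩ : Joins g a₂ b₁) (h⟨a₁,b₃⟩ : Joins h a₁ (FiveCycle.v₂ cq)) where
    private
      module CP = FiveCycle cp
      module CQ = FiveCycle cq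

      P-Q-disjoint : ∀ {x a b} → Incident P x a → Incident Q x b → ⊥
      P-Q-disjoint = distinct-circuits-vertex-disjoint P-circuit Q-circuit P≢Q

      links : List Edge
      links = g ∷ h ∷ []

      g≢h : g ≢ h
      g≢h refl with endOf-joins h⟨a₁,b₃⟩ (joins-end₁ g⟨a₂,b₁⟩)
      ... | inj₁ a₂≡a₁ = joins-distinct (CP.joins 0F) (sym a₂≡a₁)
      ... | inj₂ a₂≡b₃ = P-Q-disjoint (CP.edge∈D 0F , joins-end₂ (CP.joins 0F))
                           (CQ.edge∈D 2F , subst (λ x → EndOf x CQ.e₂) (sym a₂≡b₃) (joins-end₁ (CQ.joins 2F)))

      F-edge∉links : ∀ {e} → e ∈ F → ¬ e ∈ˡ links
      F-edge∉links e∈F (here refl)         = g∉F e∈F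
      F-edge∉links e∈F (there (here refl)) = h∉F e∈F

      vertices-disjoint : Disjoint CP.vertices CQ.vertices
      vertices-disjoint (x∈P , x∈Q) =
        P-Q-disjoint (proj₂ (CP.vertex-incident x∈P)) (proj₂ (CQ.vertex-incident x∈Q))

      Q-edges-vs-links : Disjoint CQ.edges links
      Q-edges-vs-links (e∈Q , e∈links) =
        F-edge∉links (proj₂ Q-circuit (All.lookup CQ.edges⊆D e∈Q)) e∈links

      P-edges-vs-rest : Disjoint CP.edges (CQ.edges ++ links)
      P-edges-vs-rest (e∈P , e∈rest) with ∈-++⁻ CQ.edges e∈rest
      ... | inj₁ e∈Q     =
        P-Q-disjoint (All.lookup CP.edges⊆D e∈P , inj₁ refl) (All.lookup CQ.edges⊆D e∈Q , inj₁ refl)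
      ... | inj₂ e∈links = F-edge∉links (proj₂ P-circuit (All.lookup CP.edges⊆D e∈P)) e∈links

      -- S's vertices a₁ a₂ x y z b₁ b₂ b₃ p q are those of cp followed by those of cq, and its
      -- edges a₂b₁ and a₁b₃ are g and h.
      vertex-map : Fin 10 → Vertex
      vertex-map = List.lookup (CP.vertices ++ CQ.vertices)

      edge-map : Fin 12 → Edge
      edge-map = List.lookup (CP.edges ++ CQ.edges ++ links)

      preserves-ends : ∀ e → Joins (edge-map e) (vertex-map (S-end₁ e)) (vertex-map (S-end₂ e))
      preserves-ends 0F             = CP.joins 0F
      preserves-ends 1F             = CP.joins 1F
      preserves-ends 2F             = CP.joins 2F
      preserves-ends 3F             = CP.joins 3F
      preserves-ends 4F             = CP.joins 4F
      preserves-ends 5F             = CQ.joins 0F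
      preserves-ends 6F             = CQ.joins 1F
      preserves-ends 7F             = CQ.joins 2F
      preserves-ends 8F             = CQ.joins 3F
      preserves-ends 9F             = CQ.joins 4F
      preserves-ends (suc 9F)       = g⟨a₂,b₁⟩
      preserves-ends (suc (suc 9F)) = h⟨a₁,b₃⟩

      embedding : Embedding S G
      embedding = record
        { φ     = vertex-map
        ; ψ     = edge-map
        ; φ-inj = lookup-injective (++⁺ CP.vertices-distinct CQ.vertices-distinct vertices-disjoint)
        ; ψ-inj = lookup-injective (++⁺ CP.edges-distinct
                    (++⁺ CQ.edges-distinct ((g≢h ∷ []) ∷ [] ∷ []) Q-edges-vs-links) P-edges-vs-rest)
        ; ends  = preserves-ends
        }

    S-copy : CommonCopyOfS G P Q
    S-copy = embedding
           , (λ e e∈P → ∈⇒lookup (∈-++⁺ˡ (CP.D⊆edges e∈P)))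
           , (λ e e∈Q → ∈⇒lookup (∈-++⁺ʳ CP.edges (∈-++⁺ˡ (CQ.D⊆edges e∈Q))))

  module _ {C X D ec u w ex} (C-circuit : CircuitOf G F C) (X-circuit : CircuitOf G F X) (X≢C : X ≢ C)
           (C-five : Circuit5 G C) (X-five : Circuit5 G X) (cd : FiveCycle D ec u w)
           (ec∈C : ec ∈ C) (ex∈D : ex ∈ D) (ex∈X : ex ∈ X) where
    open FiveCycle cd

    forward-along : ∀ {Y} → CircuitOf G F Y →
      ∀ i → edge i ∈ Y → edge (cyclicSuc i) ∈ F → edge (cyclicSuc i) ∈ Y
    forward-along Y-circuit i eᵢ∈Y eᵢ₊₁∈F =
      absorbs Y-circuit (eᵢ∈Y , joins-end₂ (joins i)) (eᵢ₊₁∈F , joins-end₁ (joins (cyclicSuc i)))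

    backward-along : ∀ {Y} → CircuitOf G F Y → ∀ i → edge (cyclicSuc i) ∈ Y → edge i ∈ F → edge i ∈ Y
    backward-along Y-circuit i eᵢ₊₁∈Y eᵢ∈F =
      absorbs Y-circuit (eᵢ₊₁∈Y , joins-end₁ (joins (cyclicSuc i))) (eᵢ∈F , joins-end₂ (joins i))

    not-both-non-F : ∀ i → i ≢ cyclicSuc i → edge i ∉ F → edge (cyclicSuc i) ∉ F → ⊥
    not-both-non-F i i≢i⁺ eᵢ∉F eᵢ₊₁∉F = non-F-edges-not-adjacent eᵢ∉F eᵢ₊₁∉F (distinct-edges i≢i⁺)
      (joins-end₂ (joins i)) (joins-end₁ (joins (cyclicSuc i)))

    Excluded : Edge → Set
    Excluded e = e ∈ C ⊎ e ∉ F

    excluded⇒∉X : ∀ {e} → Excluded e → e ∉ X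
    excluded⇒∉X (inj₁ e∈C) e∈X = X≢C (sym (circuits-sharing-edge-equal C-circuit X-circuit e∈C e∈X))
    excluded⇒∉X (inj₂ e∉F) e∈X = e∉F (proj₂ X-circuit e∈X)

    X-edge : ∃[ j ] edge j ∈ X
    X-edge with ∈⇒lookup (D⊆edges ex∈D)
    ... | j , refl = j , ex∈X

    all-excluded-impossible : All Excluded edges → ⊥
    all-excluded-impossible excluded =
      let j , eⱼ∈X = X-edge in excluded⇒∉X (All.lookup excluded (∈-lookup j)) eⱼ∈X

    C-cycle : ∀ {g x y} → g ∈ C → Joins g x y → FiveCycle C g x y
    C-cycle = FiveCircuitProperties.build C C-five

    X-cycle : ∀ {g x y} → g ∈ X → Joins g x y → FiveCycle X g x y
    X-cycle = FiveCircuitProperties.build X X-five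

    links-e₁-e₄ : e₁ ∉ F → e₂ ∈ F → e₃ ∈ F → e₄ ∉ F → CommonCopyOfS G C X
    links-e₁-e₄ e₁∉F e₂∈F e₃∈F e₄∉F =
      S-copy C-circuit X-circuit (≢-sym X≢C) cp cq e₁∉F e₄∉F (joins 1F) e₄⟨u,b₃⟩
      where
      e₂∈X : e₂ ∈ X
      e₂∈X with X-edge
      ... | 0F , eⱼ∈X = ⊥-elim (excluded⇒∉X (inj₁ ec∈C) eⱼ∈X)
      ... | 1F , eⱼ∈X = ⊥-elim (excluded⇒∉X (inj₂ e₁∉F) eⱼ∈X)
      ... | 2F , e₂∈X = e₂∈X
      ... | 3F , e₃∈X = backward-along X-circuit 2F e₃∈X e₂∈F
      ... | 4F , eⱼ∈X = ⊥-elim (excluded⇒∉X (inj₂ e₄∉F) eⱼ∈X)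
      cp : FiveCycle C ec u w
      cp = C-cycle ec∈C (joins 0F)
      cq : FiveCycle X e₂ v₂ v₃
      cq = X-cycle e₂∈X (joins 2F)
      e₄⟨u,b₃⟩ : Joins e₄ u (FiveCycle.v₂ cq)
      e₄⟨u,b₃⟩ = subst (Joins e₄ u) (sym (CircuitProperties.second-vertex X (proj₁ X-circuit) cq
                   (forward-along X-circuit 2F e₂∈X e₃∈F) (distinct-edges {3F} {2F} (λ ())) (joins 3F)))
                   (joins-sym (joins 4F))

    links-e₂-e₄ : e₁ ∈ F → e₂ ∉ F → e₃ ∈ F → e₄ ∉ F → CommonCopyOfS G C X
    links-e₂-e₄ e₁∈F e₂∉F e₃∈F e₄∉F =
      common-copy-sym (S-copy X-circuit C-circuit X≢C cp cq e₄∉F e₂∉F (joins 4F) e₂⟨v₃,b₃⟩)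
      where
      e₁∈C : e₁ ∈ C
      e₁∈C = forward-along C-circuit 0F ec∈C e₁∈F
      e₃∈X : e₃ ∈ X
      e₃∈X with X-edge
      ... | 0F , eⱼ∈X = ⊥-elim (excluded⇒∉X (inj₁ ec∈C) eⱼ∈X)
      ... | 1F , eⱼ∈X = ⊥-elim (excluded⇒∉X (inj₁ e₁∈C) eⱼ∈X)
      ... | 2F , eⱼ∈X = ⊥-elim (excluded⇒∉X (inj₂ e₂∉F) eⱼ∈X)
      ... | 3F , e₃∈X = e₃∈X
      ... | 4F , eⱼ∈X = ⊥-elim (excluded⇒∉X (inj₂ e₄∉F) eⱼ∈X)
      cp : FiveCycle X e₃ v₃ v₄
      cp = X-cycle e₃∈X (joins 3F)
      cq : FiveCycle C ec u w
      cq = C-cycle ec∈C (joins 0F)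
      e₂⟨v₃,b₃⟩ : Joins e₂ v₃ (FiveCycle.v₂ cq)
      e₂⟨v₃,b₃⟩ = subst (Joins e₂ v₃) (sym (CircuitProperties.second-vertex C (proj₁ C-circuit) cq e₁∈C
                    (distinct-edges {1F} {0F} (λ ())) (joins 1F))) (joins-sym (joins 2F))

    links-e₁-e₃ : e₁ ∉ F → e₂ ∈ F → e₃ ∉ F → e₄ ∈ F → CommonCopyOfS G C X
    links-e₁-e₃ e₁∉F e₂∈F e₃∉F e₄∈F =
      common-copy-sym (S-copy X-circuit C-circuit X≢C cp cq e₃∉F e₁∉F (joins 3F) e₁⟨v₂,b₃⟩)
      where
      e₄∈C : e₄ ∈ C
      e₄∈C = backward-along C-circuit 4F ec∈C e₄∈F
      e₂∈X : e₂ ∈ X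
      e₂∈X with X-edge
      ... | 0F , eⱼ∈X = ⊥-elim (excluded⇒∉X (inj₁ ec∈C) eⱼ∈X)
      ... | 1F , eⱼ∈X = ⊥-elim (excluded⇒∉X (inj₂ e₁∉F) eⱼ∈X)
      ... | 2F , e₂∈X = e₂∈X
      ... | 3F , eⱼ∈X = ⊥-elim (excluded⇒∉X (inj₂ e₃∉F) eⱼ∈X)
      ... | 4F , eⱼ∈X = ⊥-elim (excluded⇒∉X (inj₁ e₄∈C) eⱼ∈X)
      cp : FiveCycle X e₂ v₂ v₃
      cp = X-cycle e₂∈X (joins 2F)
      cq : FiveCycle C e₄ v₄ u
      cq = C-cycle e₄∈C (joins 4F)
      e₁⟨v₂,b₃⟩ : Joins e₁ v₂ (FiveCycle.v₂ cq)
      e₁⟨v₂,b₃⟩ = subst (Joins e₁ v₂) (sym (CircuitProperties.second-vertex C (proj₁ C-circuit) cq ec∈C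
                    (distinct-edges {0F} {4F} (λ ())) (joins 0F))) (joins-sym (joins 1F))

    common-copy : CommonCopyOfS G C X
    common-copy with e₁ ∈? F | e₂ ∈? F | e₃ ∈? F | e₄ ∈? F
    ... | no e₁∉F  | no e₂∉F  | _        | _        = ⊥-elim (not-both-non-F 1F (λ ()) e₁∉F e₂∉F)
    ... | _        | no e₂∉F  | no e₃∉F  | _        = ⊥-elim (not-both-non-F 2F (λ ()) e₂∉F e₃∉F)
    ... | _        | _        | no e₃∉F  | no e₄∉F  = ⊥-elim (not-both-non-F 3F (λ ()) e₃∉F e₄∉F)
    ... | no e₁∉F  | yes e₂∈F | no e₃∉F  | yes e₄∈F = links-e₁-e₃ e₁∉F e₂∈F e₃∉F e₄∈F
    ... | no e₁∉F  | yes e₂∈F | yes e₃∈F | no e₄∉F  = links-e₁-e₄ e₁∉F e₂∈F e₃∈F e₄∉F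
    ... | yes e₁∈F | no e₂∉F  | yes e₃∈F | no e₄∉F  = links-e₂-e₄ e₁∈F e₂∉F e₃∈F e₄∉F
    ... | yes e₁∈F | yes e₂∈F | yes e₃∈F | yes e₄∈F =
      let e₁∈C = forward-along C-circuit 0F ec∈C e₁∈F
          e₂∈C = forward-along C-circuit 1F e₁∈C e₂∈F
          e₃∈C = forward-along C-circuit 2F e₂∈C e₃∈F
          e₄∈C = forward-along C-circuit 3F e₃∈C e₄∈F
      in ⊥-elim (all-excluded-impossible (inj₁ ec∈C ∷ inj₁ e₁∈C ∷ inj₁ e₂∈C ∷ inj₁ e₃∈C ∷ inj₁ e₄∈C ∷ []))
    ... | no e₁∉F  | yes e₂∈F | yes e₃∈F | yes e₄∈F =
      let e₄∈C = backward-along C-circuit 4F ec∈C e₄∈F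
          e₃∈C = backward-along C-circuit 3F e₄∈C e₃∈F
          e₂∈C = backward-along C-circuit 2F e₃∈C e₂∈F
      in ⊥-elim (all-excluded-impossible (inj₁ ec∈C ∷ inj₂ e₁∉F ∷ inj₁ e₂∈C ∷ inj₁ e₃∈C ∷ inj₁ e₄∈C ∷ []))
    ... | yes e₁∈F | no e₂∉F  | yes e₃∈F | yes e₄∈F =
      let e₁∈C = forward-along C-circuit 0F ec∈C e₁∈F
          e₄∈C = backward-along C-circuit 4F ec∈C e₄∈F
          e₃∈C = backward-along C-circuit 3F e₄∈C e₃∈F
      in ⊥-elim (all-excluded-impossible (inj₁ ec∈C ∷ inj₁ e₁∈C ∷ inj₂ e₂∉F ∷ inj₁ e₃∈C ∷ inj₁ e₄∈C ∷ []))
    ... | yes e₁∈F | yes e₂∈F | no e₃∉F  | yes e₄∈F =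
      let e₁∈C = forward-along C-circuit 0F ec∈C e₁∈F
          e₂∈C = forward-along C-circuit 1F e₁∈C e₂∈F
          e₄∈C = backward-along C-circuit 4F ec∈C e₄∈F
      in ⊥-elim (all-excluded-impossible (inj₁ ec∈C ∷ inj₁ e₁∈C ∷ inj₁ e₂∈C ∷ inj₂ e₃∉F ∷ inj₁ e₄∈C ∷ []))
    ... | yes e₁∈F | yes e₂∈F | yes e₃∈F | no e₄∉F  =
      let e₁∈C = forward-along C-circuit 0F ec∈C e₁∈F
          e₂∈C = forward-along C-circuit 1F e₁∈C e₂∈F
          e₃∈C = forward-along C-circuit 2F e₂∈C e₃∈F
      in ⊥-elim (all-excluded-impossible (inj₁ ec∈C ∷ inj₁ e₁∈C ∷ inj₁ e₂∈C ∷ inj₁ e₃∈C ∷ inj₂ e₄∉F ∷ []))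

  linked-circuits-common-copy : ∀ {C X D} → CircuitOf G F C → Circuit5 G C → CircuitOf G F X → Circuit5 G X →
    X ≢ C → Circuit5 G D → Intersect G D C → Intersect G D X → CommonCopyOfS G C X
  linked-circuits-common-copy {C} {X} {D} C-circuit C-five X-circuit X-five X≢C D-five
                              (ec , ec∈D∩C) (ex , ex∈D∩X) =
    let ec∈D , ec∈C = x∈p∩q⁻ D C ec∈D∩C
        ex∈D , ex∈X = x∈p∩q⁻ D X ex∈D∩X
        cd = FiveCircuitProperties.build D D-five ec∈D (inj₁ (refl , refl))
    in common-copy C-circuit X-circuit X≢C C-five X-five cd ec∈C ex∈D ex∈X

-- The pairs 𝒫_G(F, >₁)

_≟ₛ_ : ∀ {m} → DecidableEquality (Subset m)
_≟ₛ_ = Vecₚ.≡-dec Bool._≟_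

module _ (G : Graph) (F : EdgeSet G) (_>₁_ : EdgeSet G → EdgeSet G → Set) (f : EdgeSet G → EdgeSet G) where

  -- Since f C ∈ 𝒞^I_G(F), the first alternative of f_{>₁} (choosing outside 𝒞^I_G(F)) cannot have been taken.
  f∈𝒮 : IsF G F _>₁_ f → ∀ {C} → CP G F _>₁_ f C → SS G F C (f C)
  f∈𝒮 isF {C} (C∈𝒞ᴵ , fC∈𝒞ᴵ , _) =
    proj₁ (proj₂ (isF C C∈𝒞ᴵ) (λ outside → proj₂ (proj₁ (isF C C∈𝒞ᴵ) outside) fC∈𝒞ᴵ))

  blocks-partition : (∀ {C} → CP G F _>₁_ f C → C ≢ f C) → PartitionIntoPairs G F _>₁_ f
  blocks-partition C≢fC =
    (λ C C∈𝒞ᴾ → C≢fC C∈𝒞ᴾ , block⊆𝒞ᴾ C∈𝒞ᴾ) , equal-or-disjoint , (λ X X∈𝒞ᴾ → X , X∈𝒞ᴾ , inj₁ refl)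
    where
    Block = InBlock G F _>₁_ f

    block⊆𝒞ᴾ : ∀ {C} → CP G F _>₁_ f C → ∀ X → Block C X → CP G F _>₁_ f X
    block⊆𝒞ᴾ C∈𝒞ᴾ                  X (inj₁ refl) = C∈𝒞ᴾ
    block⊆𝒞ᴾ (C∈𝒞ᴵ , fC∈𝒞ᴵ , ffC≡C) X (inj₂ refl) =
      fC∈𝒞ᴵ , subst (CIF G F) (sym ffC≡C) C∈𝒞ᴵ , cong f ffC≡C

    equal-or-disjoint : ∀ C D → CP G F _>₁_ f C → CP G F _>₁_ f D →
      (∀ X → (Block C X → Block D X) × (Block D X → Block C X)) ⊎ (∀ X → ¬ (Block C X × Block D X))
    equal-or-disjoint C D (_ , _ , ffC≡C) (_ , _ , ffD≡D) with C ≟ₛ D | C ≟ₛ f D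
    ... | yes refl | _      = inj₁ (λ X → id , id)
    ... | no _     | yes refl = inj₁ (λ X → swap-block , swap-block′)
      where
      swap-block : ∀ {X} → Block (f D) X → Block D X
      swap-block (inj₁ X≡fD) = inj₂ X≡fD
      swap-block (inj₂ X≡ffD) = inj₁ (trans X≡ffD ffD≡D)
      swap-block′ : ∀ {X} → Block D X → Block (f D) X
      swap-block′ (inj₁ X≡D) = inj₂ (trans X≡D (sym ffD≡D))
      swap-block′ (inj₂ X≡fD) = inj₁ X≡fD
    ... | no C≢D   | no C≢fD = inj₂ disjoint
      where
      disjoint : ∀ X → ¬ (Block C X × Block D X)
      disjoint X (inj₁ X≡C , inj₁ X≡D)   = C≢D (trans (sym X≡C) X≡D)
      disjoint X (inj₁ X≡C , inj₂ X≡fD)  = C≢fD (trans (sym X≡C) X≡fD)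
      disjoint X (inj₂ X≡fC , inj₁ X≡D)  = C≢fD (trans (sym ffC≡C) (cong f (trans (sym X≡fC) X≡D)))
      disjoint X (inj₂ X≡fC , inj₂ X≡fD) =
        C≢D (trans (sym ffC≡C) (trans (cong f (trans (sym X≡fC) X≡fD)) ffD≡D))

lemma11 : (G : Graph) (F : EdgeSet G) →
    Cubic G → Bridgeless G → TwoFactor G F → FiveOddEdgeConnectedQuotient G F →
    (_>₁_ : EdgeSet G → EdgeSet G → Set) → StrictTotalOnCIF G F _>₁_ →
    (f : EdgeSet G → EdgeSet G) → IsF G F _>₁_ f →
    PartitionIntoPairs G F _>₁_ f
    × (∀ C → CP G F _>₁_ f C →
         Σ (Embedding S G) (λ emb → ContainedIn emb C × ContainedIn emb (f C)))
lemma11 G F cubic bridgeless two-factor _ _>₁_ _ f isF =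
  blocks-partition G F _>₁_ f (λ C∈𝒞ᴾ C≡fC → proj₁ (proj₂ (f∈𝒮 G F _>₁_ f isF C∈𝒞ᴾ)) (sym C≡fC))
  , copies
  where
  open TwoFactorProperties G cubic (Incidence.cubic-bridgeless⇒loopless G cubic bridgeless) F two-factor
  copies : ∀ C → CP G F _>₁_ f C → CommonCopyOfS G C (f C)
  copies C C∈𝒞ᴾ@((C-circuit , C-five , _) , (X-circuit , X-five , _) , _)
    with f∈𝒮 G F _>₁_ f isF C∈𝒞ᴾ
  ... | _ , X≢C , _ , D-five , D∩C , D∩X =
    linked-circuits-common-copy C-circuit C-five X-circuit X-five X≢C D-five D∩C D∩X
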